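{- Let $q$ be a power of a prime $p$, let $k\ge1$ and let $v$ be a positive divisor of $p^k-1$. Let $T\in\mathbb{F}_q[x]$ be a separable monic polynomial of degree $>2$ which splits over $\mathbb{F}_q$, and assume $x\mid T(x)$ and that $A(x)=T(x^v)/x^{v-1}$ is a $p^k$-additive polynomial which is separable, monic, of degree $>2$ and splits over $\mathbb{F}_q$. Then $F\mapsto F^v$ is a well-defined map $\mathcal W(A\mid\mathbb{F}_q)\to\mathcal W(T\mid\mathbb{F}_q)$. In particular, $$|\mathcal W(T\mid\mathbb{F}_q)|\ge\frac{|\mathcal W(A\mid\mathbb{F}_q)|-1}{v}+1.$$
   Context: A $p^k$-additive polynomial is one of the form $\sum_{i=0}^m\omega_i x^{p^{ki}}$ with $\omega_i\in\mathbb{F}_q$. For a separable monic polynomial $S$ of degree $>2$ splitting over $\mathbb{F}_q$, $\mathcal W(S\mid\mathbb{F}_q):=\{F\in\mathbb{F}_q[x]: S(F)=\theta(x^q-x)F' \text{ for some }\theta\in\mathbb{F}_q^*\}$. -}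

module Defs where

open import Level using (0ℓ)
open import Data.Nat as ℕ using (ℕ; zero; suc; _^_; _<_)
open import Data.Nat.Primality using (Prime)
open import Data.List using (List; []; _∷_; length; replicate; _++_; foldr)
open import Data.List.Relation.Unary.All using (All)
open import Data.List.Relation.Unary.Any using (Any)
open import Data.List.Relation.Unary.AllPairs using (AllPairs)
open import Data.Product using (Σ; ∃; _×_; _,_)
open import Relation.Binary.PropositionalEquality using (_≡_; _≢_)
open import Relation.Nullary using (¬_)
open import Algebra.Structures using (IsCommutativeRing)

record FiniteField (q : ℕ) : Set₁ where
  field
    Carrier : Set
    _+_ _*_ : Carrier → Carrier → Carrier
    -_ : Carrier → Carrier
    0# 1# : Carrier
    isCommutativeRing : IsCommutativeRing _≡_ _+_ _*_ -_ 0# 1#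
    0≢1 : 0# ≢ 1#
    inverse : ∀ x → x ≢ 0# → Σ Carrier (λ y → x * y ≡ 1#)
    elements : List Carrier
    elements-unique : AllPairs _≢_ elements
    elements-complete : ∀ x → Any (x ≡_) elements
    elements-size : length elements ≡ q

-- Polynomials over 𝔽 as coefficient lists (constant term first);
-- equality is coefficientwise (trailing zeros are irrelevant).
module Poly {q : ℕ} (𝔽 : FiniteField q) where
  open FiniteField 𝔽

  Pol : Set
  Pol = List Carrier

  coeff : Pol → ℕ → Carrier
  coeff []      _       = 0#
  coeff (a ∷ f) zero    = a
  coeff (a ∷ f) (suc i) = coeff f i

  infix 4 _≈_
  _≈_ : Pol → Pol → Set
  f ≈ g = ∀ i → coeff f i ≡ coeff g i

  const : Carrier → Pol
  const a = a ∷ []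

  add : Pol → Pol → Pol
  add []      g       = g
  add (a ∷ f) []      = a ∷ f
  add (a ∷ f) (b ∷ g) = (a + b) ∷ add f g

  scale : Carrier → Pol → Pol
  scale c []      = []
  scale c (a ∷ f) = (c * a) ∷ scale c f

  neg : Pol → Pol
  neg = scale (- 1#)

  sub : Pol → Pol → Pol
  sub f g = add f (neg g)

  mul : Pol → Pol → Pol
  mul []      g = []
  mul (a ∷ f) g = add (scale a g) (0# ∷ mul f g)

  pow : Pol → ℕ → Pol
  pow f zero    = const 1#
  pow f (suc n) = mul f (pow f n)

  X^ : ℕ → Pol
  X^ n = replicate n 0# ++ (1# ∷ [])

  comp : Pol → Pol → Pol
  comp []      G = []
  comp (a ∷ f) G = add (const a) (mul G (comp f G))

  natMul : ℕ → Carrier → Carrier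
  natMul zero    a = 0#
  natMul (suc n) a = a + natMul n a

  derivFrom : ℕ → Pol → Pol
  derivFrom n []      = []
  derivFrom n (b ∷ f) = natMul n b ∷ derivFrom (suc n) f

  deriv : Pol → Pol
  deriv []      = []
  deriv (a ∷ f) = derivFrom 1 f

  MonicOfDegree : Pol → ℕ → Set
  MonicOfDegree S d = coeff S d ≡ 1# × (∀ i → d < i → coeff S i ≡ 0#)

  MonicDegGt2 : Pol → Set
  MonicDegGt2 S = Σ ℕ (λ d → 2 < d × MonicOfDegree S d)

  Separable : Pol → Set
  Separable S = Σ Pol (λ a → Σ Pol (λ b → add (mul a S) (mul b (deriv S)) ≈ const 1#))

  linProd : List Carrier → Pol
  linProd = foldr (λ r acc → mul ((- r) ∷ 1# ∷ []) acc) (const 1#)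

  Splits : Pol → Set
  Splits S = Σ (List Carrier) (λ rs → S ≈ linProd rs)

  Divides : Pol → Pol → Set
  Divides f g = Σ Pol (λ h → g ≈ mul f h)

  additiveFrom : ℕ → ℕ → ℕ → List Carrier → Pol
  additiveFrom p k i []       = []
  additiveFrom p k i (w ∷ ws) = add (scale w (X^ (p ^ (k ℕ.* i)))) (additiveFrom p k (suc i) ws)

  IsAdditive : ℕ → ℕ → Pol → Set
  IsAdditive p k A = Σ (List Carrier) (λ ω → A ≈ additiveFrom p k 0 ω)

  InW : Pol → Pol → Set
  InW S F = Σ Carrier (λ θ → θ ≢ 0# × comp S F ≈ scale θ (mul (sub (X^ q) (X^ 1)) (deriv F)))

  Enumerates : (Pol → Set) → List Pol → Set
  Enumerates P L = All P L × (∀ F → P F → Any (F ≈_) L) × AllPairs (λ f g → ¬ (f ≈ g)) L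

{-# OPTIONS --safe #-}
module Submission where

-- If A(F) = θ(x^q − x)F′, then T(x^v) = x^(v−1)A(x) gives T(F^v) = F^(v−1)A(F), and since
-- (F^v)′ = v·F^(v−1)F′ this is (θ/v)(x^q − x)(F^v)′; here v·1 ≠ 0 in 𝔽_q, as q·1 = 0 and v divides
-- p^k − 1. For the count, x ∣ T puts 0 in 𝒲(T); the only F with F^v = 0 is 0, and a nonzero G has at
-- most v preimages under F ↦ F^v, since these are roots of the monic Y^v − G over the domain 𝔽_q[x].

open import Defs
open import Level using (Level; 0ℓ)
open import Algebra using (CommutativeRing)
open import Data.Nat as ℕ using (ℕ; zero; suc; _≤_; z≤n; s≤s)
open import Data.List using (List; []; _∷_; length; map; filter; foldr; replicate; drop; _++_)
open import Data.List.Relation.Unary.All as All using (All; []; _∷_)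
open import Data.List.Relation.Unary.Any as Any using (Any; here; there)
open import Data.List.Relation.Unary.AllPairs as AllPairs using (AllPairs; []; _∷_)
open import Data.Product using (Σ; _,_; proj₁; proj₂)
open import Data.Sum using (_⊎_; inj₁; inj₂)
open import Relation.Binary.PropositionalEquality as ≡ using (_≡_; _≢_; refl; cong; cong₂; subst)
open import Relation.Nullary using (¬_; Dec; yes; no; contradiction)

module Lists where
  open import Data.Nat using (_+_; _*_)
  open import Data.Nat.Properties using (+-mono-≤; +-monoˡ-≤; +-suc; *-suc; +-assoc; suc-injective; module ≤-Reasoning)
  open import Data.Nat.Tactic.RingSolver using (solve-∀)
  open import Data.Nat.ListAction using (sum)
  open import Data.Product using (_×_)
  open import Data.List.Properties using (filter-accept; filter-reject)
  open import Data.List.Membership.Propositional using (_∈_)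
  open import Data.List.Membership.Propositional.Properties using (∈-∃++; ∈-++⁻; ∈-++⁺ˡ; ∈-++⁺ʳ)
  open import Data.List.Relation.Binary.Permutation.Propositional using (_↭_; ↭-refl; ↭-trans; ↭-sym; prep)
  open import Data.List.Relation.Binary.Permutation.Propositional.Properties using (shift; ↭-length)
  import Data.List.Relation.Unary.All.Properties as Allₚ
  import Data.List.Relation.Unary.AllPairs.Properties as AllPairsₚ
  open import Relation.Unary using (Pred; Decidable)
  open import Relation.Unary.Properties using (∁?)

  private
    variable
      a b ℓ ℓ′ : Level

  length≤filter+filter : {A : Set a} {P : Pred A ℓ} (P? : Decidable P) →
                         ∀ xs → length xs ≤ length (filter P? xs) + length (filter (∁? P?) xs)
  length≤filter+filter P? []       = z≤n
  length≤filter+filter {A = A} {P = P} P? (x ∷ xs) = split (P? x)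
    where
    sizes : List A → List A → ℕ
    sizes ys zs = length ys + length zs
    ih : length xs ≤ sizes (filter P? xs) (filter (∁? P?) xs)
    ih = length≤filter+filter P? xs
    split : Dec (P x) → suc (length xs) ≤ sizes (filter P? (x ∷ xs)) (filter (∁? P?) (x ∷ xs))
    split (yes px) = subst (suc (length xs) ≤_)
      (≡.sym (cong₂ sizes (filter-accept P? px) (filter-reject (∁? P?) (λ ¬px → ¬px px)))) (s≤s ih)
    split (no ¬px) = subst (suc (length xs) ≤_)
      (≡.trans (≡.sym (+-suc _ _)) (≡.sym (cong₂ sizes (filter-reject P? ¬px) (filter-accept (∁? P?) ¬px))))
      (s≤s ih)

  ↭-of-unique-⊆ : {A : Set a} {xs ys : List A} →
                  AllPairs _≢_ xs → All (_∈ ys) xs → length xs ≡ length ys → xs ↭ ys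
  ↭-of-unique-⊆ {xs = []}     {[]} _             _               _   = ↭-refl
  ↭-of-unique-⊆ {xs = x ∷ xs} {ys} (x∉xs ∷ uniq) (x∈ys ∷ xs⊆ys) len with ∈-∃++ x∈ys
  ... | as , bs , refl =
    ↭-trans (prep x (↭-of-unique-⊆ uniq (All.zipWith drop-x (x∉xs , xs⊆ys)) len′)) (↭-sym (shift x as bs))
    where
    drop-x : ∀ {z} → x ≢ z × z ∈ as ++ x ∷ bs → z ∈ as ++ bs
    drop-x (x≢z , z∈) with ∈-++⁻ as z∈
    ... | inj₁ z∈as        = ∈-++⁺ˡ z∈as
    ... | inj₂ (here z≡x)  = contradiction (≡.sym z≡x) x≢z
    ... | inj₂ (there z∈bs) = ∈-++⁺ʳ as z∈bs
    len′ : length xs ≡ length (as ++ bs)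
    len′ = suc-injective (≡.trans len (↭-length (shift x as bs)))

  module FibreCounting
    {A : Set a} {B : Set b} (_#_ : A → A → Set ℓ)
    (_∼_ : B → B → Set ℓ′) (_∼?_ : ∀ x y → Dec (x ∼ y))
    (f : A → B) (bound : B → ℕ)
    (fibre-bound : ∀ y xs → AllPairs _#_ xs → All (λ x → f x ∼ y) xs → length xs ≤ bound y)
    where

    length≤sum-bounds : ∀ ys xs → AllPairs _#_ xs → All (λ x → Any (f x ∼_) ys) xs →
                        length xs ≤ sum (map bound ys)
    length≤sum-bounds []       []      _        _        = z≤n
    length≤sum-bounds []       (_ ∷ _) _        (() ∷ _)
    length≤sum-bounds (y ∷ ys) xs      distinct inImage = begin
      length xs
        ≤⟨ length≤filter+filter fibre? xs ⟩
      length (filter fibre? xs) + length (filter (∁? fibre?) xs)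
        ≤⟨ +-mono-≤ (fibre-bound y _ (AllPairsₚ.filter⁺ fibre? distinct) (Allₚ.all-filter fibre? xs))
                    (length≤sum-bounds ys _ (AllPairsₚ.filter⁺ (∁? fibre?) distinct) inRest) ⟩
      bound y + sum (map bound ys) ∎
      where
      open ≤-Reasoning
      fibre? : Decidable (λ x → f x ∼ y)
      fibre? x = f x ∼? y
      outside : ∀ {x} → Any (f x ∼_) (y ∷ ys) → ¬ (f x ∼ y) → Any (f x ∼_) ys
      outside (here fx∼y) fx≁y = contradiction fx∼y fx≁y
      outside (there p)   _    = p
      inRest : All (λ x → Any (f x ∼_) ys) (filter (∁? fibre?) xs)
      inRest = All.zipWith (λ (p , q) → outside p q)
                 (Allₚ.filter⁺ (∁? fibre?) inImage , Allₚ.all-filter (∁? fibre?) xs)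

  module _ {A : Set a} (bound : A → ℕ) {v : ℕ} (bound≤v : ∀ y → bound y ≤ v) where

    sum≤*length : ∀ ys → sum (map bound ys) ≤ v * length ys
    sum≤*length []       = z≤n
    sum≤*length (y ∷ ys) = subst (sum (map bound (y ∷ ys)) ≤_) (≡.sym (*-suc v (length ys)))
                                 (+-mono-≤ (bound≤v y) (sum≤*length ys))

    sum+≤*length+1 : ∀ {ys} → Any (λ y → bound y ≤ 1) ys → sum (map bound ys) + v ≤ v * length ys + 1
    sum+≤*length+1 {y ∷ ys} (here y≤1) = begin
      bound y + sum (map bound ys) + v ≤⟨ +-monoˡ-≤ v (+-mono-≤ y≤1 (sum≤*length ys)) ⟩
      1 + v * length ys + v            ≡⟨ shuffle v (length ys) ⟩
      v * suc (length ys) + 1          ∎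
      where
      open ≤-Reasoning
      shuffle : ∀ v n → 1 + v * n + v ≡ v * suc n + 1
      shuffle = solve-∀
    sum+≤*length+1 {y ∷ ys} (there p) = begin
      bound y + sum (map bound ys) + v ≡⟨ +-assoc (bound y) _ v ⟩
      bound y + (sum (map bound ys) + v) ≤⟨ +-mono-≤ (bound≤v y) (sum+≤*length+1 p) ⟩
      v + (v * length ys + 1)          ≡⟨ shuffle v (length ys) ⟩
      v * suc (length ys) + 1          ∎
      where
      open ≤-Reasoning
      shuffle : ∀ v n → v + (v * n + 1) ≡ v * suc n + 1
      shuffle = solve-∀

module MonicRoots {c ℓ} (R : CommutativeRing c ℓ) where
  open import Data.Product using (_×_)

  open CommutativeRing R renaming (refl to ≈-refl)
  open import Algebra.Properties.Semiring.Exp semiring using (_^_)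
  open import Algebra.Properties.AbelianGroup +-abelianGroup using (x∙y⁻¹≈ε⇒x≈y)
  open import Relation.Binary.Reasoning.Setoid setoid
  open import Algebra.Solver.Ring.NaturalCoefficients.Default commutativeSemiring

  -- The solver below works over commutative semirings, so y - r enters it as y + n with an
  -- independent atom n = - r, and this lemma supplies the relation r + n ≈ 0 afterwards.
  x+[r-r]*z≈x : ∀ x r z → x + (r - r) * z ≈ x
  x+[r-r]*z≈x x r z = trans (+-congˡ (trans (*-congʳ (-‿inverseʳ r)) (zeroˡ z))) (+-identityʳ x)

  -- monic P is the monic polynomial of degree length P whose lower coefficients are P, in Horner form.
  monic : List Carrier → Carrier → Carrier
  monic []       y = 1#
  monic (c ∷ cs) y = c + y * monic cs y

  monic-factor : ∀ c cs r → Σ (List Carrier) λ Q → length Q ≡ length cs ×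
                 (∀ y → monic (c ∷ cs) y ≈ (y - r) * monic Q y + monic (c ∷ cs) r)
  monic-factor c []        r = [] , refl , λ y → begin
    c + y * 1#                    ≈⟨ x+[r-r]*z≈x _ r 1# ⟨
    c + y * 1# + (r - r) * 1#     ≈⟨ solve 4 (λ y n r c → c :+ y :* con 1 :+ (r :+ n) :* con 1
                                              := (y :+ n) :* con 1 :+ (c :+ r :* con 1)) ≈-refl y (- r) r c ⟩
    (y - r) * 1# + (c + r * 1#)   ∎
  monic-factor c (c′ ∷ cs) r with monic-factor c′ cs r
  ... | Q , lenQ , factored = e ∷ Q , cong suc lenQ , λ y → begin
    c + y * monic (c′ ∷ cs) y
      ≈⟨ +-congˡ (*-congˡ (factored y)) ⟩
    c + y * ((y - r) * monic Q y + e)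
      ≈⟨ x+[r-r]*z≈x _ r e ⟨
    c + y * ((y - r) * monic Q y + e) + (r - r) * e
      ≈⟨ solve 6 (λ y n r c e q → c :+ y :* ((y :+ n) :* q :+ e) :+ (r :+ n) :* e
                                  := (y :+ n) :* (e :+ y :* q) :+ (c :+ r :* e))
               ≈-refl y (- r) r c e (monic Q y) ⟩
    (y - r) * (e + y * monic Q y) + (c + r * e) ∎
    where
    e : Carrier
    e = monic (c′ ∷ cs) r

  monic-replicate-0 : ∀ n y → monic (replicate n 0#) y ≈ y ^ n
  monic-replicate-0 zero    y = ≈-refl
  monic-replicate-0 (suc n) y = trans (+-identityˡ _) (*-congˡ (monic-replicate-0 n y))

  module _ (no-zero-divisors : ∀ {x y} → x * y ≈ 0# → x ≈ 0# ⊎ y ≈ 0#) (1≉0 : ¬ 1# ≈ 0#) where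

    roots≤degree : ∀ P rs → AllPairs (λ r s → ¬ r ≈ s) rs → All (λ r → monic P r ≈ 0#) rs →
                   length rs ≤ length P
    roots≤degree P        []       _              _            = z≤n
    roots≤degree []       (r ∷ rs) _              (1≈0 ∷ _)    = contradiction 1≈0 1≉0
    roots≤degree (c ∷ cs) (r ∷ rs) (r∉rs ∷ dist) (Pr≈0 ∷ Prs≈0) with monic-factor c cs r
    ... | Q , lenQ , factored =
      subst (suc (length rs) ≤_) (cong suc lenQ) (s≤s (roots≤degree Q rs dist (All.zipWith root-of-Q (r∉rs , Prs≈0))))
      where
      root-of-Q : ∀ {s} → (¬ r ≈ s) × monic (c ∷ cs) s ≈ 0# → monic Q s ≈ 0#
      root-of-Q {s} (r≉s , Ps≈0) with no-zero-divisors (begin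
          (s - r) * monic Q s                ≈⟨ +-identityʳ _ ⟨
          (s - r) * monic Q s + 0#           ≈⟨ +-congˡ Pr≈0 ⟨
          (s - r) * monic Q s + monic (c ∷ cs) r ≈⟨ factored s ⟨
          monic (c ∷ cs) s                   ≈⟨ Ps≈0 ⟩
          0#                                 ∎)
      ... | inj₁ s-r≈0 = contradiction (sym (x∙y⁻¹≈ε⇒x≈y s r s-r≈0)) r≉s
      ... | inj₂ Qs≈0  = Qs≈0

module FiniteFieldProperties {q : ℕ} (𝔽 : FiniteField q) where
  import Data.Nat.Properties as ℕₚ
  open import Data.Nat.Divisibility using (_∣_; divides)
  open import Data.List.Properties using (length-map)
  open import Data.List.Relation.Binary.Permutation.Propositional using (_↭_; ↭⇒↭ₛ)
  import Data.List.Relation.Binary.Permutation.Setoid.Properties as PermutationSetoid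
  import Data.List.Relation.Unary.AllPairs.Properties as AllPairsₚ
  open import Relation.Binary.Definitions using (DecidableEquality)
  open import Relation.Binary.PropositionalEquality using (setoid; module ≡-Reasoning)

  open Lists using (↭-of-unique-⊆)
  open FiniteField 𝔽
    using (Carrier; isCommutativeRing; 0≢1; inverse; elements; elements-unique; elements-complete; elements-size)

  commutativeRing : CommutativeRing 0ℓ 0ℓ
  commutativeRing = record { isCommutativeRing = isCommutativeRing }

  open CommutativeRing commutativeRing hiding (Carrier; refl; sym; trans; setoid)
  open import Algebra.Properties.Semiring.Mult semiring using (_×_; ×-homo-+; ×1-homo-*)
  open ≡-Reasoning

  open import Algebra.Properties.AbelianGroup +-abelianGroup using (∙-cancelˡ; identityˡ-unique)
  open import Algebra.Properties.CommutativeSemigroup +-commutativeSemigroup using (interchange)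

  private
    ∉⇒≢ : ∀ {x y : Carrier} {zs} → All (x ≢_) zs → Any (y ≡_) zs → x ≢ y
    ∉⇒≢ (x≢z ∷ _)  (here y≡z) x≡y = x≢z (≡.trans x≡y y≡z)
    ∉⇒≢ (_ ∷ x∉zs) (there y∈zs)   = ∉⇒≢ x∉zs y∈zs

    ≟-by-position : ∀ {x y : Carrier} {zs} → AllPairs _≢_ zs → Any (x ≡_) zs → Any (y ≡_) zs → Dec (x ≡ y)
    ≟-by-position _          (here x≡z)   (here y≡z)   = yes (≡.trans x≡z (≡.sym y≡z))
    ≟-by-position (z∉zs ∷ _) (here x≡z)   (there y∈zs) = no λ x≡y → ∉⇒≢ z∉zs y∈zs (≡.trans (≡.sym x≡z) x≡y)
    ≟-by-position (z∉zs ∷ _) (there x∈zs) (here y≡z)   = no λ x≡y → ∉⇒≢ z∉zs x∈zs (≡.trans (≡.sym y≡z) (≡.sym x≡y))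
    ≟-by-position (_ ∷ uniq) (there x∈zs) (there y∈zs) = ≟-by-position uniq x∈zs y∈zs

  _≟_ : DecidableEquality Carrier
  x ≟ y = ≟-by-position elements-unique (elements-complete x) (elements-complete y)

  *-≢0 : ∀ {x y} → x ≢ 0# → y ≢ 0# → x * y ≢ 0#
  *-≢0 {x} {y} x≢0 y≢0 xy≡0 = y≢0 (begin
    y                  ≡⟨ *-identityˡ y ⟨
    1# * y             ≡⟨ cong (_* y) (≡.trans (≡.sym x⁻¹x) (*-comm x _)) ⟩
    (x⁻¹ * x) * y      ≡⟨ *-assoc x⁻¹ x y ⟩
    x⁻¹ * (x * y)      ≡⟨ cong (x⁻¹ *_) xy≡0 ⟩
    x⁻¹ * 0#           ≡⟨ zeroʳ x⁻¹ ⟩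
    0#                 ∎)
    where
    x⁻¹ : Carrier
    x⁻¹ = proj₁ (inverse x x≢0)
    x⁻¹x : x * x⁻¹ ≡ 1#
    x⁻¹x = proj₂ (inverse x x≢0)

  private
    sum : List Carrier → Carrier
    sum = foldr _+_ 0#

    sum-translate : ∀ xs → sum (map (1# +_) xs) ≡ length xs × 1# + sum xs
    sum-translate []       = ≡.sym (+-identityʳ 0#)
    sum-translate (x ∷ xs) = ≡.trans (cong ((1# + x) +_) (sum-translate xs)) (interchange 1# x _ _)

    translate-↭ : map (1# +_) elements ↭ elements
    translate-↭ = ↭-of-unique-⊆
      (AllPairsₚ.map⁺ (AllPairs.map (λ x≢y 1+x≡1+y → x≢y (∙-cancelˡ 1# _ _ 1+x≡1+y)) elements-unique))
      (All.tabulate (λ {y} _ → elements-complete y))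
      (length-map (1# +_) elements)

  -- Translation by 1 permutes the elements, so it leaves their sum unchanged.
  q×1≡0 : q × 1# ≡ 0#
  q×1≡0 = identityˡ-unique (q × 1#) (sum elements) (begin
    q × 1# + sum elements                  ≡⟨ cong (λ n → n × 1# + sum elements) elements-size ⟨
    length elements × 1# + sum elements    ≡⟨ sum-translate elements ⟨
    sum (map (1# +_) elements)
      ≡⟨ PermutationSetoid.foldr-commMonoid (setoid Carrier) +-isCommutativeMonoid (↭⇒↭ₛ translate-↭) ⟩
    sum elements                           ∎)

  ×1-of-pow : ∀ {a} → a × 1# ≡ 1# → ∀ n → (a ℕ.^ n) × 1# ≡ 1#
  ×1-of-pow a×1≡1 zero    = +-identityʳ 1#
  ×1-of-pow {a} a×1≡1 (suc n) = begin
    (a ℕ.* a ℕ.^ n) × 1#         ≡⟨ ×1-homo-* a (a ℕ.^ n) ⟩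
    a × 1# * (a ℕ.^ n) × 1#      ≡⟨ cong₂ _*_ a×1≡1 (×1-of-pow a×1≡1 n) ⟩
    1# * 1#                      ≡⟨ *-identityʳ 1# ⟩
    1#                           ∎

  ×1≢0-of-∣-pow∸1 : ∀ {p n k v} → q ≡ p ℕ.^ n → .{{ℕ.NonZero p}} →
                    v ∣ p ℕ.^ suc k ℕ.∸ 1 → v × 1# ≢ 0#
  ×1≢0-of-∣-pow∸1 {p} {n} {k} {v} q≡pⁿ (divides t pᵏ∸1≡tv) v×1≡0 = 0≢1 (begin
    0#                          ≡⟨ zeroˡ _ ⟨
    0# * (q ℕ.^ k) × 1#         ≡⟨ cong (_* (q ℕ.^ k) × 1#) q×1≡0 ⟨
    q × 1# * (q ℕ.^ k) × 1#     ≡⟨ ×1-homo-* q _ ⟨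
    (q ℕ.^ suc k) × 1#          ≡⟨ cong (λ m → (m ℕ.^ suc k) × 1#) q≡pⁿ ⟩
    ((p ℕ.^ n) ℕ.^ suc k) × 1#  ≡⟨ cong (_× 1#) pⁿ^sk≡pˢᵏ^n ⟩
    (pᵏ ℕ.^ n) × 1#            ≡⟨ ×1-of-pow pᵏ×1≡1 n ⟩
    1#                         ∎)
    where
    pᵏ : ℕ
    pᵏ = p ℕ.^ suc k
    pᵏ∸1×1≡0 : (pᵏ ℕ.∸ 1) × 1# ≡ 0#
    pᵏ∸1×1≡0 = ≡.trans (cong (_× 1#) pᵏ∸1≡tv)
                 (≡.trans (×1-homo-* t v) (≡.trans (cong (t × 1# *_) v×1≡0) (zeroʳ _)))
    pᵏ×1≡1 : pᵏ × 1# ≡ 1#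
    pᵏ×1≡1 = begin
      pᵏ × 1#                   ≡⟨ cong (_× 1#) (ℕₚ.m+[n∸m]≡n (ℕₚ.m^n>0 p (suc k))) ⟨
      (1 ℕ.+ (pᵏ ℕ.∸ 1)) × 1#   ≡⟨ ×-homo-+ 1# 1 (pᵏ ℕ.∸ 1) ⟩
      1 × 1# + (pᵏ ℕ.∸ 1) × 1#  ≡⟨ cong₂ _+_ (+-identityʳ 1#) pᵏ∸1×1≡0 ⟩
      1# + 0#                   ≡⟨ +-identityʳ 1# ⟩
      1#                        ∎
    pⁿ^sk≡pˢᵏ^n : (p ℕ.^ n) ℕ.^ suc k ≡ pᵏ ℕ.^ n
    pⁿ^sk≡pˢᵏ^n = ≡.trans (ℕₚ.^-*-assoc p n (suc k))
      (≡.trans (cong (p ℕ.^_) (ℕₚ.*-comm n (suc k))) (≡.sym (ℕₚ.^-*-assoc p (suc k) n)))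

module PolynomialRing {q : ℕ} (𝔽 : FiniteField q) where
  open import Algebra using (CommutativeSemigroup)
  open import Algebra.Structures using (IsCommutativeSemigroup)

  open FiniteFieldProperties 𝔽 using (commutativeRing; _≟_; *-≢0)
  module F where
    open CommutativeRing commutativeRing public
    open import Algebra.Properties.Ring ring using (-1*x≈-x) public
  open F using (Carrier; _+_; _*_; -_; 0#; 1#)
  open Poly 𝔽

  coeff-add : ∀ f g i → coeff (add f g) i ≡ coeff f i + coeff g i
  coeff-add []      g       i       = ≡.sym (F.+-identityˡ _)
  coeff-add (a ∷ f) []      i       = ≡.sym (F.+-identityʳ _)
  coeff-add (a ∷ f) (b ∷ g) zero    = refl
  coeff-add (a ∷ f) (b ∷ g) (suc i) = coeff-add f g i

  coeff-scale : ∀ c f i → coeff (scale c f) i ≡ c * coeff f i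
  coeff-scale c []      i       = ≡.sym (F.zeroʳ c)
  coeff-scale c (a ∷ f) zero    = refl
  coeff-scale c (a ∷ f) (suc i) = coeff-scale c f i

  -- A proof of f ≈ g is a function, from which Agda cannot read off f and g; the record
  -- wrapper makes them inferable.
  infix 4 _≋_
  record _≋_ (f g : Pol) : Set where
    constructor coeffwise
    field coeff-≡ : f ≈ g
  open _≋_ public

  ≋-refl : ∀ {f} → f ≋ f
  ≋-refl = coeffwise λ _ → refl

  ≋-sym : ∀ {f g} → f ≋ g → g ≋ f
  ≋-sym (coeffwise e) = coeffwise λ i → ≡.sym (e i)

  ≋-trans : ∀ {f g h} → f ≋ g → g ≋ h → f ≋ h
  ≋-trans (coeffwise e) (coeffwise e′) = coeffwise λ i → ≡.trans (e i) (e′ i)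

  ∷-cong : ∀ {a b f g} → a ≡ b → f ≋ g → a ∷ f ≋ b ∷ g
  ∷-cong a≡b (coeffwise e) = coeffwise λ { zero → a≡b ; (suc i) → e i }

  0∷-zero : ∀ {f} → f ≋ [] → 0# ∷ f ≋ []
  0∷-zero (coeffwise e) = coeffwise λ { zero → refl ; (suc i) → e i }

  ∷-zero : ∀ {a f} → a ≡ 0# → f ≋ [] → a ∷ f ≋ []
  ∷-zero refl = 0∷-zero

  head-≡ : ∀ {f g} → f ≋ g → coeff f 0 ≡ coeff g 0
  head-≡ (coeffwise e) = e 0

  tail-≋ : ∀ {a f g} → a ∷ f ≋ g → f ≋ drop 1 g
  tail-≋ {g = []}    (coeffwise e) = coeffwise λ i → e (suc i)
  tail-≋ {g = _ ∷ _} (coeffwise e) = coeffwise λ i → e (suc i)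

  add-cong : ∀ {f f′ g g′} → f ≋ f′ → g ≋ g′ → add f g ≋ add f′ g′
  add-cong {f} {f′} {g} {g′} (coeffwise e) (coeffwise e′) = coeffwise λ i →
    ≡.trans (coeff-add f g i) (≡.trans (cong₂ _+_ (e i) (e′ i)) (≡.sym (coeff-add f′ g′ i)))

  scale-cong : ∀ {c d f g} → c ≡ d → f ≋ g → scale c f ≋ scale d g
  scale-cong {c} {d} {f} {g} c≡d (coeffwise e) = coeffwise λ i →
    ≡.trans (coeff-scale c f i) (≡.trans (cong₂ _*_ c≡d (e i)) (≡.sym (coeff-scale d g i)))

  add-comm : ∀ f g → add f g ≋ add g f
  add-comm f g = coeffwise λ i →
    ≡.trans (coeff-add f g i) (≡.trans (F.+-comm _ _) (≡.sym (coeff-add g f i)))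

  add-assoc : ∀ f g h → add (add f g) h ≋ add f (add g h)
  add-assoc f g h = coeffwise λ i → begin
    coeff (add (add f g) h) i               ≡⟨ coeff-add (add f g) h i ⟩
    coeff (add f g) i + coeff h i           ≡⟨ cong (_+ coeff h i) (coeff-add f g i) ⟩
    coeff f i + coeff g i + coeff h i       ≡⟨ F.+-assoc _ _ _ ⟩
    coeff f i + (coeff g i + coeff h i)     ≡⟨ cong (coeff f i +_) (coeff-add g h i) ⟨
    coeff f i + coeff (add g h) i           ≡⟨ coeff-add f (add g h) i ⟨
    coeff (add f (add g h)) i               ∎
    where open ≡.≡-Reasoning

  add-identityʳ : ∀ f → add f [] ≋ f
  add-identityʳ f = coeffwise λ i → ≡.trans (coeff-add f [] i) (F.+-identityʳ _)

  add-inverseʳ : ∀ f → add f (neg f) ≋ []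
  add-inverseʳ f = coeffwise λ i → ≡.trans (coeff-add f (neg f) i)
    (≡.trans (cong (coeff f i +_) (≡.trans (coeff-scale (- 1#) f i) (F.-1*x≈-x _))) (F.-‿inverseʳ _))

  scale-zero : ∀ f → scale 0# f ≋ []
  scale-zero f = coeffwise λ i → ≡.trans (coeff-scale 0# f i) (F.zeroˡ _)

  scale-one : ∀ f → scale 1# f ≋ f
  scale-one f = coeffwise λ i → ≡.trans (coeff-scale 1# f i) (F.*-identityˡ _)

  scale-distribˡ : ∀ c f g → scale c (add f g) ≋ add (scale c f) (scale c g)
  scale-distribˡ c f g = coeffwise λ i → begin
    coeff (scale c (add f g)) i                    ≡⟨ coeff-scale c (add f g) i ⟩
    c * coeff (add f g) i                          ≡⟨ cong (c *_) (coeff-add f g i) ⟩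
    c * (coeff f i + coeff g i)                    ≡⟨ F.distribˡ c _ _ ⟩
    c * coeff f i + c * coeff g i                  ≡⟨ cong₂ _+_ (coeff-scale c f i) (coeff-scale c g i) ⟨
    coeff (scale c f) i + coeff (scale c g) i      ≡⟨ coeff-add (scale c f) (scale c g) i ⟨
    coeff (add (scale c f) (scale c g)) i          ∎
    where open ≡.≡-Reasoning

  scale-distribʳ : ∀ c d f → scale (c + d) f ≋ add (scale c f) (scale d f)
  scale-distribʳ c d f = coeffwise λ i → begin
    coeff (scale (c + d) f) i                      ≡⟨ coeff-scale (c + d) f i ⟩
    (c + d) * coeff f i                            ≡⟨ F.distribʳ _ c d ⟩
    c * coeff f i + d * coeff f i                  ≡⟨ cong₂ _+_ (coeff-scale c f i) (coeff-scale d f i) ⟨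
    coeff (scale c f) i + coeff (scale d f) i      ≡⟨ coeff-add (scale c f) (scale d f) i ⟨
    coeff (add (scale c f) (scale d f)) i          ∎
    where open ≡.≡-Reasoning

  scale-scale : ∀ c d f → scale c (scale d f) ≋ scale (c * d) f
  scale-scale c d f = coeffwise λ i → ≡.trans (coeff-scale c (scale d f) i)
    (≡.trans (cong (c *_) (coeff-scale d f i)) (≡.trans (≡.sym (F.*-assoc _ _ _)) (≡.sym (coeff-scale _ f i))))

  add-isCommutativeSemigroup : IsCommutativeSemigroup _≋_ add
  add-isCommutativeSemigroup = record
    { isSemigroup = record
      { isMagma = record
        { isEquivalence = record { refl = ≋-refl ; sym = ≋-sym ; trans = ≋-trans }
        ; ∙-cong = add-cong }
      ; assoc = add-assoc }
    ; comm = add-comm }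

  add-commutativeSemigroup : CommutativeSemigroup 0ℓ 0ℓ
  add-commutativeSemigroup = record { isCommutativeSemigroup = add-isCommutativeSemigroup }

  open import Algebra.Properties.CommutativeSemigroup add-commutativeSemigroup using (interchange; x∙yz≈y∙xz)

  mul-zeroʳ : ∀ f → mul f [] ≋ []
  mul-zeroʳ []      = ≋-refl
  mul-zeroʳ (a ∷ f) = 0∷-zero (mul-zeroʳ f)

  mul-zeroˡ : ∀ {f} g → f ≋ [] → mul f g ≋ []
  mul-zeroˡ {[]}    g f≋0 = ≋-refl
  mul-zeroˡ {a ∷ f} g f≋0 = ≋-trans
    (add-cong (≋-trans (scale-cong (head-≡ f≋0) ≋-refl) (scale-zero g)) (∷-cong refl (mul-zeroˡ g (tail-≋ f≋0))))
    (0∷-zero ≋-refl)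

  mul-congˡ : ∀ {f f′} g → f ≋ f′ → mul f g ≋ mul f′ g
  mul-congˡ {[]}    {f′}     g e = ≋-sym (mul-zeroˡ g (≋-sym e))
  mul-congˡ {a ∷ f} {[]}     g e = mul-zeroˡ g e
  mul-congˡ {a ∷ f} {b ∷ f′} g e = add-cong (scale-cong (head-≡ e) ≋-refl) (∷-cong refl (mul-congˡ g (tail-≋ e)))

  mul-congʳ : ∀ f {g g′} → g ≋ g′ → mul f g ≋ mul f g′
  mul-congʳ []      e = ≋-refl
  mul-congʳ (a ∷ f) e = add-cong (scale-cong refl e) (∷-cong refl (mul-congʳ f e))

  mul-cong : ∀ {f f′ g g′} → f ≋ f′ → g ≋ g′ → mul f g ≋ mul f′ g′
  mul-cong {f′ = f′} {g = g} e e′ = ≋-trans (mul-congˡ g e) (mul-congʳ f′ e′)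

  0∷-add : ∀ f g → 0# ∷ add f g ≋ add (0# ∷ f) (0# ∷ g)
  0∷-add f g = ∷-cong (≡.sym (F.+-identityʳ 0#)) ≋-refl

  mul-distribʳ : ∀ f g h → mul (add f g) h ≋ add (mul f h) (mul g h)
  mul-distribʳ []      g       h = ≋-refl
  mul-distribʳ (a ∷ f) []      h = ≋-sym (add-identityʳ _)
  mul-distribʳ (a ∷ f) (b ∷ g) h = ≋-trans
    (add-cong (scale-distribʳ a b h) (≋-trans (∷-cong refl (mul-distribʳ f g h)) (0∷-add (mul f h) (mul g h))))
    (interchange (scale a h) (scale b h) (0# ∷ mul f h) (0# ∷ mul g h))

  scale-0∷ : ∀ c f → scale c (0# ∷ f) ≋ 0# ∷ scale c f
  scale-0∷ c f = ∷-cong (F.zeroʳ c) ≋-refl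

  mul-scaleˡ : ∀ c f g → mul (scale c f) g ≋ scale c (mul f g)
  mul-scaleˡ c []      g = ≋-refl
  mul-scaleˡ c (a ∷ f) g = ≋-trans
    (add-cong (≋-sym (scale-scale c a g)) (≋-trans (∷-cong refl (mul-scaleˡ c f g)) (≋-sym (scale-0∷ c (mul f g)))))
    (≋-sym (scale-distribˡ c (scale a g) (0# ∷ mul f g)))

  mul-consʳ : ∀ f b g → mul f (b ∷ g) ≋ add (scale b f) (0# ∷ mul f g)
  mul-consʳ []      b g = ≋-sym (0∷-zero ≋-refl)
  mul-consʳ (a ∷ f) b g = ∷-cong (cong (_+ 0#) (F.*-comm a b))
    (≋-trans (add-cong (≋-refl {scale a g}) (mul-consʳ f b g)) (x∙yz≈y∙xz (scale a g) (scale b f) (0# ∷ mul f g)))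

  mul-comm : ∀ f g → mul f g ≋ mul g f
  mul-comm []      g = ≋-sym (mul-zeroʳ g)
  mul-comm (a ∷ f) g = ≋-trans (add-cong ≋-refl (∷-cong refl (mul-comm f g))) (≋-sym (mul-consʳ g a f))

  mul-0∷ˡ : ∀ f h → mul (0# ∷ f) h ≋ 0# ∷ mul f h
  mul-0∷ˡ f h = add-cong (scale-zero h) ≋-refl

  mul-assoc : ∀ f g h → mul (mul f g) h ≋ mul f (mul g h)
  mul-assoc []      g h = ≋-refl
  mul-assoc (a ∷ f) g h = ≋-trans (mul-distribʳ (scale a g) (0# ∷ mul f g) h)
    (add-cong (mul-scaleˡ a g h) (≋-trans (mul-0∷ˡ (mul f g) h) (∷-cong refl (mul-assoc f g h))))

  mul-identityˡ : ∀ f → mul (const 1#) f ≋ f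
  mul-identityˡ f = ≋-trans (add-cong (scale-one f) (0∷-zero ≋-refl)) (add-identityʳ f)

  mul-distribˡ : ∀ f g h → mul f (add g h) ≋ add (mul f g) (mul f h)
  mul-distribˡ f g h = ≋-trans (mul-comm f (add g h))
    (≋-trans (mul-distribʳ g h f) (add-cong (mul-comm g f) (mul-comm h f)))

  polynomialRing : CommutativeRing 0ℓ 0ℓ
  polynomialRing = record
    { Carrier = Pol ; _≈_ = _≋_ ; _+_ = add ; _*_ = mul ; -_ = neg ; 0# = [] ; 1# = const 1#
    ; isCommutativeRing = record
      { isRing = record
        { +-isAbelianGroup = record
          { isGroup = record
            { isMonoid = record
              { isSemigroup = IsCommutativeSemigroup.isSemigroup add-isCommutativeSemigroup
              ; identity = (λ f → ≋-refl) , add-identityʳ }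
            ; inverse = (λ f → ≋-trans (add-comm (neg f) f) (add-inverseʳ f)) , add-inverseʳ
            ; ⁻¹-cong = scale-cong refl }
          ; comm = add-comm }
        ; *-cong = mul-cong
        ; *-assoc = mul-assoc
        ; *-identity = mul-identityˡ , (λ f → ≋-trans (mul-comm f _) (mul-identityˡ f))
        ; distrib = mul-distribˡ , (λ f g h → mul-distribʳ g h f) }
      ; *-comm = mul-comm } }

  ≋[]? : ∀ f → Dec (f ≋ [])
  ≋[]? []      = yes ≋-refl
  ≋[]? (a ∷ f) with a ≟ 0# | ≋[]? f
  ... | yes a≡0 | yes f≋0 = yes (∷-zero a≡0 f≋0)
  ... | no  a≢0 | _       = no λ e → a≢0 (head-≡ e)
  ... | yes _   | no  f≉0 = no λ e → f≉0 (tail-≋ e)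

  _≋?_ : ∀ f g → Dec (f ≋ g)
  [] ≋? g with ≋[]? g
  ... | yes g≋0 = yes (≋-sym g≋0)
  ... | no  g≉0 = no λ e → g≉0 (≋-sym e)
  (a ∷ f) ≋? [] = ≋[]? (a ∷ f)
  (a ∷ f) ≋? (b ∷ g) with a ≟ b | f ≋? g
  ... | yes a≡b | yes f≋g = yes (∷-cong a≡b f≋g)
  ... | no  a≢b | _       = no λ e → a≢b (head-≡ e)
  ... | yes _   | no  f≉g = no λ e → f≉g (tail-≋ e)

  mul-0∷ʳ : ∀ f h → mul f (0# ∷ h) ≋ 0# ∷ mul f h
  mul-0∷ʳ f h = ≋-trans (mul-comm f (0# ∷ h)) (≋-trans (mul-0∷ˡ h f) (∷-cong refl (mul-comm h f)))

  private
    ∷-mul-≉[] : ∀ {a} f → a ≢ 0# → ∀ g → ¬ g ≋ [] → ¬ mul (a ∷ f) g ≋ []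
    ∷-mul-≉[] f a≢0 []      g≉0 _ = contradiction ≋-refl g≉0
    ∷-mul-≉[] f a≢0 (b ∷ g) g≉0 e with b ≟ 0#
    ... | no  b≢0 = *-≢0 a≢0 b≢0 (≡.trans (≡.sym (F.+-identityʳ _)) (head-≡ e))
    ... | yes b≡0 = ∷-mul-≉[] f a≢0 g (λ g≋0 → g≉0 (∷-zero b≡0 g≋0))
      (tail-≋ (≋-trans (≋-sym (≋-trans (mul-congʳ (_ ∷ f) (∷-cong b≡0 ≋-refl)) (mul-0∷ʳ (_ ∷ f) g))) e))

  mul-≉[] : ∀ f g → ¬ f ≋ [] → ¬ g ≋ [] → ¬ mul f g ≋ []
  mul-≉[] []      g f≉0 _   = contradiction ≋-refl f≉0
  mul-≉[] (a ∷ f) g f≉0 g≉0 e with a ≟ 0#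
  ... | no  a≢0 = ∷-mul-≉[] f a≢0 g g≉0 e
  ... | yes a≡0 = mul-≉[] f g (λ f≋0 → f≉0 (∷-zero a≡0 f≋0)) g≉0
    (tail-≋ (≋-trans (≋-sym (≋-trans (mul-congˡ g (∷-cong a≡0 (≋-refl {f}))) (mul-0∷ˡ f g))) e))

  no-zero-divisors : ∀ {f g} → mul f g ≋ [] → f ≋ [] ⊎ g ≋ []
  no-zero-divisors {f} {g} fg≋0 with ≋[]? f | ≋[]? g
  ... | yes f≋0 | _       = inj₁ f≋0
  ... | no  _   | yes g≋0 = inj₂ g≋0
  ... | no  f≉0 | no  g≉0 = contradiction fg≋0 (mul-≉[] f g f≉0 g≉0)

  pow-≋[] : ∀ F m → pow F (suc m) ≋ [] → F ≋ []
  pow-≋[] F zero Fᵐ⁺¹≋0 with no-zero-divisors Fᵐ⁺¹≋0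
  ... | inj₁ F≋0 = F≋0
  ... | inj₂ 1≋0 = contradiction (≡.sym (head-≡ 1≋0)) (FiniteField.0≢1 𝔽)
  pow-≋[] F (suc m) Fᵐ⁺¹≋0 with no-zero-divisors Fᵐ⁺¹≋0
  ... | inj₁ F≋0  = F≋0
  ... | inj₂ Fᵐ≋0 = pow-≋[] F m Fᵐ≋0


module PolynomialCalculus {q : ℕ} (𝔽 : FiniteField q) where
  open import Data.Nat.Properties using (+-identityʳ; +-suc)
  open Poly 𝔽
  open PolynomialRing 𝔽
  open F using (_+_; _*_; 0#; 1#)

  open import Algebra.Properties.Semiring.Mult F.semiring using (_×_; ×-comm-*)
  open import Algebra.Properties.CommutativeMonoid.Mult F.+-commutativeMonoid using (×-distrib-+)

  X : Pol
  X = X^ 1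

  mul-X : ∀ h → mul X h ≋ 0# ∷ h
  mul-X h = ≋-trans (mul-0∷ˡ (const 1#) h) (∷-cong refl (mul-identityˡ h))

  ∷-as-X : ∀ a f → a ∷ f ≋ add (const a) (mul X f)
  ∷-as-X a f = ≋-sym (≋-trans (add-cong (≋-refl {const a}) (mul-X f)) (∷-cong (F.+-identityʳ a) ≋-refl))

  scale-as-mul : ∀ c f → scale c f ≋ mul (const c) f
  scale-as-mul c f = ≋-sym (≋-trans (add-cong (≋-refl {scale c f}) (0∷-zero ≋-refl)) (add-identityʳ _))

  const-* : ∀ a b → const (a * b) ≋ mul (const a) (const b)
  const-* a b = ∷-cong (≡.sym (F.+-identityʳ _)) ≋-refl

  const-zero : const 0# ≋ []
  const-zero = 0∷-zero ≋-refl

  ×-zeroʳ : ∀ n → n × 0# ≡ 0#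
  ×-zeroʳ zero    = refl
  ×-zeroʳ (suc n) = ≡.trans (F.+-identityˡ _) (×-zeroʳ n)

  natMul≗× : ∀ n a → natMul n a ≡ n × a
  natMul≗× zero    a = refl
  natMul≗× (suc n) a = cong (a +_) (natMul≗× n a)

  coeff-derivFrom : ∀ n f i → coeff (derivFrom n f) i ≡ (n ℕ.+ i) × coeff f i
  coeff-derivFrom n []      i       = ≡.sym (×-zeroʳ (n ℕ.+ i))
  coeff-derivFrom n (b ∷ f) zero    = ≡.trans (natMul≗× n b) (cong (_× b) (≡.sym (+-identityʳ n)))
  coeff-derivFrom n (b ∷ f) (suc i) = ≡.trans (coeff-derivFrom (suc n) f i) (cong (_× coeff f i) (≡.sym (+-suc n i)))

  coeff-deriv : ∀ f i → coeff (deriv f) i ≡ suc i × coeff f (suc i)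
  coeff-deriv []      i = ≡.sym (×-zeroʳ (suc i))
  coeff-deriv (a ∷ f) i = coeff-derivFrom 1 f i

  deriv-add : ∀ f g → deriv (add f g) ≋ add (deriv f) (deriv g)
  deriv-add f g = coeffwise λ i → begin
    coeff (deriv (add f g)) i                        ≡⟨ coeff-deriv (add f g) i ⟩
    suc i × coeff (add f g) (suc i)                  ≡⟨ cong (suc i ×_) (coeff-add f g (suc i)) ⟩
    suc i × (coeff f (suc i) + coeff g (suc i))      ≡⟨ ×-distrib-+ _ _ (suc i) ⟩
    suc i × coeff f (suc i) + suc i × coeff g (suc i) ≡⟨ cong₂ _+_ (coeff-deriv f i) (coeff-deriv g i) ⟨
    coeff (deriv f) i + coeff (deriv g) i            ≡⟨ coeff-add (deriv f) (deriv g) i ⟨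
    coeff (add (deriv f) (deriv g)) i                ∎
    where open ≡.≡-Reasoning

  deriv-scale : ∀ c f → deriv (scale c f) ≋ scale c (deriv f)
  deriv-scale c f = coeffwise λ i → begin
    coeff (deriv (scale c f)) i         ≡⟨ coeff-deriv (scale c f) i ⟩
    suc i × coeff (scale c f) (suc i)   ≡⟨ cong (suc i ×_) (coeff-scale c f (suc i)) ⟩
    suc i × (c * coeff f (suc i))       ≡⟨ ×-comm-* (suc i) c _ ⟨
    c * (suc i × coeff f (suc i))       ≡⟨ cong (c *_) (coeff-deriv f i) ⟨
    c * coeff (deriv f) i               ≡⟨ coeff-scale c (deriv f) i ⟨
    coeff (scale c (deriv f)) i         ∎
    where open ≡.≡-Reasoning

  deriv-∷ : ∀ a f → deriv (a ∷ f) ≋ add f (0# ∷ deriv f)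
  deriv-∷ a f = coeffwise λ
    { zero    → ≡.trans (coeff-derivFrom 1 f zero) (≡.sym (coeff-add f (0# ∷ deriv f) zero))
    ; (suc i) → ≡.trans (coeff-deriv (a ∷ f) (suc i))
                 (≡.trans (cong (coeff f (suc i) +_) (≡.sym (coeff-deriv f i)))
                          (≡.sym (coeff-add f (0# ∷ deriv f) (suc i)))) }

  open import Relation.Binary.Reasoning.Setoid (CommutativeRing.setoid polynomialRing)
  open import Algebra.Solver.Ring.NaturalCoefficients.Default (CommutativeRing.commutativeSemiring polynomialRing)

  deriv-mul : ∀ f g → deriv (mul f g) ≋ add (mul (deriv f) g) (mul f (deriv g))
  deriv-mul []      g = ≋-refl
  deriv-mul (a ∷ f) g = begin
    deriv (add (scale a g) (0# ∷ mul f g))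
      ≈⟨ deriv-add (scale a g) (0# ∷ mul f g) ⟩
    add (deriv (scale a g)) (deriv (0# ∷ mul f g))
      ≈⟨ add-cong (≋-trans (deriv-scale a g) (scale-as-mul a g′))
                  (≋-trans (deriv-∷ 0# (mul f g))
                           (add-cong ≋-refl (≋-trans (≋-sym (mul-X _)) (mul-congʳ X (deriv-mul f g))))) ⟩
    add (mul (const a) g′) (add (mul f g) (mul X (add (mul f′ g) (mul f g′))))
      ≈⟨ solve 6 (λ A F G F′ G′ Y → A :* G′ :+ (F :* G :+ Y :* (F′ :* G :+ F :* G′))
                                    := (F :+ Y :* F′) :* G :+ (A :+ Y :* F) :* G′) ≋-refl (const a) f g f′ g′ X ⟩
    add (mul (add f (mul X f′)) g) (mul (add (const a) (mul X f)) g′)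
      ≈⟨ add-cong (mul-congˡ g (≋-sym (≋-trans (deriv-∷ a f) (add-cong ≋-refl (≋-sym (mul-X f′))))))
                  (mul-congˡ g′ (≋-sym (∷-as-X a f))) ⟩
    add (mul (deriv (a ∷ f)) g) (mul (a ∷ f) g′) ∎
    where
    f′ g′ : Pol
    f′ = deriv f
    g′ = deriv g

  deriv-pow : ∀ F m → deriv (pow F (suc m)) ≋ mul (const (suc m × 1#)) (mul (pow F m) (deriv F))
  deriv-pow F zero = begin
    deriv (mul F (const 1#))
      ≈⟨ deriv-mul F (const 1#) ⟩
    add (mul (deriv F) (const 1#)) (mul F [])
      ≈⟨ solve 2 (λ F′ G → F′ :* con 1 :+ G :* con 0 := con 1 :* (con 1 :* F′)) ≋-refl (deriv F) F ⟩
    mul (const 1#) (mul (const 1#) (deriv F))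
      ≈⟨ mul-congˡ (mul (const 1#) (deriv F)) (∷-cong {f = []} (≡.sym (F.+-identityʳ 1#)) ≋-refl) ⟩
    mul (const (1 × 1#)) (mul (pow F zero) (deriv F)) ∎
  deriv-pow F (suc m) = begin
    deriv (mul F (pow F (suc m)))
      ≈⟨ deriv-mul F (pow F (suc m)) ⟩
    add (mul (deriv F) (mul F (pow F m))) (mul F (deriv (pow F (suc m))))
      ≈⟨ add-cong ≋-refl (mul-congʳ F (deriv-pow F m)) ⟩
    add (mul (deriv F) (mul F (pow F m))) (mul F (mul (const (suc m × 1#)) (mul (pow F m) (deriv F))))
      ≈⟨ solve 4 (λ F′ G P C → F′ :* (G :* P) :+ G :* (C :* (P :* F′)) := (con 1 :+ C) :* ((G :* P) :* F′))
               ≋-refl (deriv F) F (pow F m) (const (suc m × 1#)) ⟩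
    mul (add (const 1#) (const (suc m × 1#))) (mul (pow F (suc m)) (deriv F)) ∎

  comp-zeroˡ : ∀ {f} G → f ≋ [] → comp f G ≋ []
  comp-zeroˡ {[]}    G f≋0 = ≋-refl
  comp-zeroˡ {a ∷ f} G f≋0 = ≋-trans
    (add-cong (∷-cong {f = []} (head-≡ f≋0) ≋-refl)
              (≋-trans (mul-congʳ G (comp-zeroˡ G (tail-≋ f≋0))) (mul-zeroʳ G)))
    (≋-trans (add-identityʳ _) const-zero)

  comp-congˡ : ∀ {f f′} G → f ≋ f′ → comp f G ≋ comp f′ G
  comp-congˡ {[]}    {f′}     G e = ≋-sym (comp-zeroˡ G (≋-sym e))
  comp-congˡ {a ∷ f} {[]}     G e = comp-zeroˡ G e
  comp-congˡ {a ∷ f} {b ∷ f′} G e = add-cong (∷-cong (head-≡ e) ≋-refl) (mul-congʳ G (comp-congˡ G (tail-≋ e)))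

  comp-congʳ : ∀ f {G G′} → G ≋ G′ → comp f G ≋ comp f G′
  comp-congʳ []      e = ≋-refl
  comp-congʳ (a ∷ f) e = add-cong ≋-refl (mul-cong e (comp-congʳ f e))

  comp-add : ∀ f g G → comp (add f g) G ≋ add (comp f G) (comp g G)
  comp-add []      g       G = ≋-refl
  comp-add (a ∷ f) []      G = ≋-sym (add-identityʳ _)
  comp-add (a ∷ f) (b ∷ g) G = begin
    add (const (a + b)) (mul G (comp (add f g) G))
      ≈⟨ add-cong (≋-refl {const (a + b)}) (mul-congʳ G (comp-add f g G)) ⟩
    add (add (const a) (const b)) (mul G (add (comp f G) (comp g G)))
      ≈⟨ solve 5 (λ A B Y P Q → (A :+ B) :+ Y :* (P :+ Q) := (A :+ Y :* P) :+ (B :+ Y :* Q))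
               ≋-refl (const a) (const b) G (comp f G) (comp g G) ⟩
    add (comp (a ∷ f) G) (comp (b ∷ g) G) ∎

  comp-scale : ∀ c f G → comp (scale c f) G ≋ mul (const c) (comp f G)
  comp-scale c []      G = ≋-sym (mul-zeroʳ (const c))
  comp-scale c (a ∷ f) G = begin
    add (const (c * a)) (mul G (comp (scale c f) G))
      ≈⟨ add-cong (const-* c a) (mul-congʳ G (comp-scale c f G)) ⟩
    add (mul (const c) (const a)) (mul G (mul (const c) (comp f G)))
      ≈⟨ solve 4 (λ C A Y P → C :* A :+ Y :* (C :* P) := C :* (A :+ Y :* P)) ≋-refl (const c) (const a) G (comp f G) ⟩
    mul (const c) (comp (a ∷ f) G) ∎

  comp-0∷ : ∀ h G → comp (0# ∷ h) G ≋ mul G (comp h G)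
  comp-0∷ h G = add-cong const-zero ≋-refl

  comp-mul : ∀ f g G → comp (mul f g) G ≋ mul (comp f G) (comp g G)
  comp-mul []      g G = ≋-refl
  comp-mul (a ∷ f) g G = begin
    comp (add (scale a g) (0# ∷ mul f g)) G
      ≈⟨ comp-add (scale a g) (0# ∷ mul f g) G ⟩
    add (comp (scale a g) G) (comp (0# ∷ mul f g) G)
      ≈⟨ add-cong (comp-scale a g G) (≋-trans (comp-0∷ (mul f g) G) (mul-congʳ G (comp-mul f g G))) ⟩
    add (mul (const a) (comp g G)) (mul G (mul (comp f G) (comp g G)))
      ≈⟨ solve 4 (λ A Q Y P → A :* Q :+ Y :* (P :* Q) := (A :+ Y :* P) :* Q) ≋-refl (const a) (comp g G) G (comp f G) ⟩
    mul (comp (a ∷ f) G) (comp g G) ∎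

  comp-const : ∀ a G → comp (const a) G ≋ const a
  comp-const a G = ≋-trans (add-cong (≋-refl {const a}) (mul-zeroʳ G)) (add-identityʳ _)

  comp-X^ : ∀ n G → comp (X^ n) G ≋ pow G n
  comp-X^ zero    G = comp-const 1# G
  comp-X^ (suc n) G = ≋-trans (comp-0∷ (X^ n) G) (mul-congʳ G (comp-X^ n G))

  comp-assoc : ∀ f G H → comp (comp f G) H ≋ comp f (comp G H)
  comp-assoc []      G H = ≋-refl
  comp-assoc (a ∷ f) G H = begin
    comp (add (const a) (mul G (comp f G))) H
      ≈⟨ comp-add (const a) (mul G (comp f G)) H ⟩
    add (comp (const a) H) (comp (mul G (comp f G)) H)
      ≈⟨ add-cong (comp-const a H) (≋-trans (comp-mul G (comp f G) H) (mul-congʳ (comp G H) (comp-assoc f G H))) ⟩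
    comp (a ∷ f) (comp G H) ∎

  comp-[]ʳ : ∀ f → comp f [] ≋ const (coeff f 0)
  comp-[]ʳ []      = ≋-sym const-zero
  comp-[]ʳ (a ∷ f) = ≋-refl

module PowerMap {q : ℕ} (𝔽 : FiniteField q) where
  open import Data.Nat.Properties using (≤-refl; ≤-trans; +-monoˡ-≤)
  open import Data.List.Properties using (length-replicate)
  open Lists using (module FibreCounting; sum+≤*length+1)

  open Poly 𝔽
  open PolynomialRing 𝔽
  open PolynomialCalculus 𝔽
  open F using (Carrier; _*_; 0#; 1#)
  open import Algebra.Properties.Semiring.Mult F.semiring using (_×_)
  open import Relation.Binary.Reasoning.Setoid (CommutativeRing.setoid polynomialRing)
  open import Algebra.Solver.Ring.NaturalCoefficients.Default (CommutativeRing.commutativeSemiring polynomialRing)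

  W : Pol
  W = sub (X^ q) (X^ 1)

  InW-pow : ∀ {v′} T A → suc v′ × 1# ≢ 0# → mul (X^ v′) A ≈ comp T (X^ (suc v′)) →
            ∀ F → InW A F → InW T (pow F (suc v′))
  InW-pow {v′} T A v≢0 xᵛ⁻¹A≈T[xᵛ] F (θ , θ≢0 , A[F]≈) = θ/v , θ/v≢0 , coeff-≡ (begin
    comp T (pow F v)
      ≈⟨ comp-congʳ T (≋-sym (comp-X^ v F)) ⟩
    comp T (comp (X^ v) F)
      ≈⟨ comp-assoc T (X^ v) F ⟨
    comp (comp T (X^ v)) F
      ≈⟨ comp-congˡ F (coeffwise {mul (X^ v′) A} {comp T (X^ v)} xᵛ⁻¹A≈T[xᵛ]) ⟨
    comp (mul (X^ v′) A) F
      ≈⟨ comp-mul (X^ v′) A F ⟩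
    mul (comp (X^ v′) F) (comp A F)
      ≈⟨ mul-cong (comp-X^ v′ F) (≋-trans (coeffwise A[F]≈) (scale-as-mul θ _)) ⟩
    mul (pow F v′) (mul (const θ) (mul W (deriv F)))
      ≈⟨ mul-congʳ (pow F v′)
           (mul-congˡ (mul W (deriv F)) (≋-trans (∷-cong (≡.sym θ/v*v≡θ) ≋-refl) (const-* θ/v c))) ⟩
    mul (pow F v′) (mul (mul (const θ/v) (const c)) (mul W (deriv F)))
      ≈⟨ solve 5 (λ P Th C Wx D → P :* ((Th :* C) :* (Wx :* D)) := Th :* (Wx :* (C :* (P :* D))))
               ≋-refl (pow F v′) (const θ/v) (const c) W (deriv F) ⟩
    mul (const θ/v) (mul W (mul (const c) (mul (pow F v′) (deriv F))))
      ≈⟨ ≋-trans (scale-as-mul θ/v _) (mul-congʳ (const θ/v) (mul-congʳ W (deriv-pow F v′))) ⟨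
    scale θ/v (mul W (deriv (pow F v))) ∎)
    where
    v : ℕ
    v = suc v′
    c c⁻¹ θ/v : Carrier
    c = v × 1#
    c⁻¹ = proj₁ (FiniteField.inverse 𝔽 c v≢0)
    θ/v = θ * c⁻¹
    θ/v*v≡θ : θ/v * c ≡ θ
    θ/v*v≡θ = ≡.trans (F.*-assoc θ c⁻¹ c)
      (≡.trans (cong (θ *_) (≡.trans (F.*-comm c⁻¹ c) (proj₂ (FiniteField.inverse 𝔽 c v≢0)))) (F.*-identityʳ θ))
    θ/v≢0 : θ/v ≢ 0#
    θ/v≢0 θ/v≡0 = θ≢0 (≡.trans (≡.sym θ/v*v≡θ) (≡.trans (cong (_* c) θ/v≡0) (F.zeroˡ c)))

  InW-zero : ∀ T → Divides (X^ 1) T → InW T []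
  InW-zero T (h , T≈xh) = 1# , (λ 1≡0 → FiniteField.0≢1 𝔽 (≡.sym 1≡0)) , coeff-≡ (begin
    comp T []                    ≈⟨ comp-[]ʳ T ⟩
    const (coeff T 0)            ≈⟨ ∷-cong T₀≡0 ≋-refl ⟩
    const 0#                     ≈⟨ const-zero ⟩
    []                           ≈⟨ mul-zeroʳ W ⟨
    mul W []                     ≈⟨ scale-one _ ⟨
    scale 1# (mul W (deriv []))  ∎)
    where
    T₀≡0 : coeff T 0 ≡ 0#
    T₀≡0 = ≡.trans (T≈xh 0) (head-≡ (mul-X h))

  open MonicRoots polynomialRing using (monic; monic-replicate-0; roots≤degree)
  open import Algebra.Properties.Semiring.Exp (CommutativeRing.semiring polynomialRing) using (_^_)

  pow≡^ : ∀ F n → pow F n ≡ F ^ n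
  pow≡^ F zero    = refl
  pow≡^ F (suc n) = cong (mul F) (pow≡^ F n)

  module _ (v′ : ℕ) where
    private
      v : ℕ
      v = suc v′

    fibreBound : Pol → ℕ
    fibreBound G with ≋[]? G
    ... | yes _ = 1
    ... | no  _ = v

    fibreBound≤v : ∀ G → fibreBound G ≤ v
    fibreBound≤v G with ≋[]? G
    ... | yes _ = s≤s z≤n
    ... | no  _ = ≤-refl

    fibreBound-[] : ∀ {G} → G ≋ [] → fibreBound G ≤ 1
    fibreBound-[] {G} G≋0 with ≋[]? G
    ... | yes _   = ≤-refl
    ... | no  G≉0 = contradiction G≋0 G≉0

    pow-fibre-bound : ∀ G Fs → AllPairs (λ F F′ → ¬ F ≋ F′) Fs → All (λ F → pow F v ≋ G) Fs →
                      length Fs ≤ fibreBound G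
    pow-fibre-bound G Fs distinct Fsᵛ≋G with ≋[]? G
    ... | yes G≋0 = at-most-one Fs distinct Fsᵛ≋G
      where
      at-most-one : ∀ Fs → AllPairs (λ F F′ → ¬ F ≋ F′) Fs → All (λ F → pow F v ≋ G) Fs → length Fs ≤ 1
      at-most-one []            _                    _                     = z≤n
      at-most-one (F ∷ [])      _                    _                     = s≤s z≤n
      at-most-one (F ∷ F′ ∷ Fs) ((F≉F′ ∷ _) ∷ _) (Fᵛ≋G ∷ F′ᵛ≋G ∷ _) =
        contradiction
          (≋-trans (pow-≋[] F v′ (≋-trans Fᵛ≋G G≋0)) (≋-sym (pow-≋[] F′ v′ (≋-trans F′ᵛ≋G G≋0))))
          F≉F′
    ... | no _ = subst (length Fs ≤_) (cong suc (length-replicate v′))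
                   (roots≤degree no-zero-divisors (λ 1≋0 → FiniteField.0≢1 𝔽 (≡.sym (head-≡ 1≋0)))
                     (neg G ∷ replicate v′ []) Fs distinct (All.map (λ {F} → root {F}) Fsᵛ≋G))
      where
      root : ∀ {F} → pow F v ≋ G → monic (neg G ∷ replicate v′ []) F ≋ []
      root {F} Fᵛ≋G = begin
        add (neg G) (mul F (monic (replicate v′ []) F))
          ≈⟨ add-cong ≋-refl (mul-congʳ F (monic-replicate-0 v′ F)) ⟩
        add (neg G) (mul F (F ^ v′))
          ≡⟨ cong (λ P → add (neg G) (mul F P)) (≡.sym (pow≡^ F v′)) ⟩
        add (neg G) (pow F v)   ≈⟨ add-cong ≋-refl Fᵛ≋G ⟩
        add (neg G) G           ≈⟨ add-comm (neg G) G ⟩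
        add G (neg G)           ≈⟨ add-inverseʳ G ⟩
        []                      ∎

  enumeration-bound : ∀ {v′} T A → Divides (X^ 1) T → (∀ F → InW A F → InW T (pow F (suc v′))) →
                      ∀ LA LT → Enumerates (InW A) LA → Enumerates (InW T) LT →
                      length LA ℕ.+ suc v′ ≤ suc v′ ℕ.* length LT ℕ.+ 1
  enumeration-bound {v′} T A x∣T W-pow LA LT (in-W-A , _ , distinct) (_ , complete-W-T , _) = ≤-trans
    (+-monoˡ-≤ (suc v′) (length≤sum-bounds LT LA
      (AllPairs.map (λ F≉F′ F≋F′ → F≉F′ (coeff-≡ F≋F′)) distinct)
      (All.map (λ {F} F∈W → Any.map coeffwise (complete-W-T _ (W-pow F F∈W))) in-W-A)))
    (sum+≤*length+1 (fibreBound v′) (fibreBound≤v v′)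
      (Any.map (λ 0≈G → fibreBound-[] v′ (≋-sym (coeffwise 0≈G))) (complete-W-T [] (InW-zero T x∣T))))
    where
    open FibreCounting (λ F F′ → ¬ F ≋ F′) _≋_ _≋?_ (λ F → pow F (suc v′)) (fibreBound v′) (pow-fibre-bound v′)

open import Data.Nat using (ℕ; _^_; _∸_; _≤_; _+_; _*_)
open import Data.Nat.Divisibility using (_∣_)
open import Data.Nat.Primality using (Prime)
open import Data.List using (List; length)
open import Data.Product using (_×_)
open import Data.Nat.Primality using (prime⇒nonZero)

proposition3p3 : (p n k v : ℕ) → Prime p → 1 ≤ n → 1 ≤ k → 1 ≤ v → v ∣ (p ^ k ∸ 1) →
    (𝔽 : FiniteField (p ^ n)) → let open Poly 𝔽 in
    (T A : Pol) →
    Separable T → MonicDegGt2 T → Splits T → Divides (X^ 1) T →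
    mul (X^ (v ∸ 1)) A ≈ comp T (X^ v) →
    IsAdditive p k A → Separable A → MonicDegGt2 A → Splits A →
    (∀ F → InW A F → InW T (pow F v)) ×
    (∀ LA LT → Enumerates (InW A) LA → Enumerates (InW T) LT →
    length LA + v ≤ v * length LT + 1)
proposition3p3 p n (suc k) (suc v′) p-prime _ _ _ v∣pᵏ∸1 𝔽 T A _ _ _ x∣T xᵛ⁻¹A≈T[xᵛ] _ _ _ _ =
  W-pow , enumeration-bound T A x∣T W-pow
  where
  open Poly 𝔽 using (InW; pow)
  open PowerMap 𝔽 using (InW-pow; enumeration-bound)
  open FiniteFieldProperties 𝔽 using (×1≢0-of-∣-pow∸1)

  W-pow : ∀ F → InW A F → InW T (pow F (suc v′))
  W-pow = InW-pow T A (×1≢0-of-∣-pow∸1 {p} {n} {k} refl {{prime⇒nonZero p-prime}} v∣pᵏ∸1) xᵛ⁻¹A≈T[xᵛ]
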